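{- Let $\Delta\ge 3$ and let $T$ be a tree rooted at a vertex $r$ with maximum degree at most $\Delta$. Suppose that for some integer $a\ge 1$ there are $m$ distinct leaves $x_1,\dots,x_m$ of $T$ with $d(r,x_i)=a$ for all $1\le i\le m$. Then there exists $i\in\{1,\dots,m\}$ such that $x_i$ witnesses at least $\log_{\Delta-1}(m/\Delta)+2$ distinct lengths, all lying between $0$ and $2a$.
   Context: $d(u,v)$ denotes the graph distance. A leaf is a vertex of degree $1$. A leaf-to-leaf path is a path whose endpoints are both leaves; its length is its number of edges, and a single vertex counts as a path of length $0$. A leaf $v$ witnesses the length $\ell$ if there is a leaf-to-leaf path of length $\ell$ in $T$ having $v$ as an endpoint. -}

module Defs where

open import Data.Nat using (ℕ; suc; _+_; _≤_)
open import Data.Fin using (Fin)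
open import Data.Bool using (Bool; true; false; if_then_else_)
open import Data.List using (List; length; map; allFin; head; last)
open import Data.Nat.ListAction using (sum)
open import Data.List.Relation.Unary.Linked using (Linked)
open import Data.List.Relation.Unary.Unique.Propositional using (Unique)
open import Data.Maybe using (just)
open import Data.Product using (Σ; ∃; _×_)
open import Relation.Binary.PropositionalEquality using (_≡_)
open import Relation.Nullary using (¬_)

record Graph (n : ℕ) : Set where
  field
    adj   : Fin n → Fin n → Bool
    sym   : ∀ u v → adj u v ≡ adj v u
    irref : ∀ v → adj v v ≡ false

module _ {n : ℕ} (G : Graph n) where
  open Graph G

  Adj : Fin n → Fin n → Set
  Adj u v = adj u v ≡ true

  deg : Fin n → ℕ
  deg v = sum (map (λ u → if adj v u then 1 else 0) (allFin n))

  IsLeaf : Fin n → Set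
  IsLeaf v = deg v ≡ 1

  MaxDegAtMost : ℕ → Set
  MaxDegAtMost Δ = ∀ v → deg v ≤ Δ

  IsPath : List (Fin n) → Set
  IsPath ps = Linked Adj ps × Unique ps

  -- a path from u to v with ℓ edges (ℓ = 0: the single vertex u = v)
  PathOfLength : Fin n → Fin n → ℕ → Set
  PathOfLength u v ℓ = Σ (List (Fin n)) λ ps →
    IsPath ps × head ps ≡ just u × last ps ≡ just v × length ps ≡ suc ℓ

  HasCycle : Set
  HasCycle = Σ (List (Fin n)) λ ps → ∃ λ u → ∃ λ v →
    IsPath ps × head ps ≡ just u × last ps ≡ just v × 3 ≤ length ps × Adj v u

  Connected : Set
  Connected = ∀ u v → ∃ λ ℓ → PathOfLength u v ℓ

  IsTree : Set
  IsTree = Connected × ¬ HasCycle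

  Dist : Fin n → Fin n → ℕ → Set
  Dist u v d = PathOfLength u v d × (∀ ℓ → PathOfLength u v ℓ → d ≤ ℓ)

  Witnesses : Fin n → ℕ → Set
  Witnesses x ℓ = IsLeaf x × ∃ λ y → IsLeaf y × PathOfLength x y ℓ

{-# OPTIONS --safe #-}
-- Read the paths of length a from r to the leaves x₁, …, x_m as words; they form a prefix tree
-- in which the root has at most Δ children and every other node at most Δ - 1, since a path
-- never returns to its predecessor. Starting from all m words, repeatedly pass to the child
-- holding the most words. A level at which the current group really splits shrinks it by a
-- factor of at most Δ - 1 (Δ at the root), and at depth a a single word is left, so the leaf
-- x_i reached has b split levels with m (Δ - 1) ≤ Δ (Δ - 1)^b. At a split level t some x_k agrees
-- with x_i exactly up to depth t; as T is acyclic the two paths meet only there, so x_i witnesses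
-- 2 (a - t). Together with the length 0 these are b + 1 distinct lengths, and
-- m (Δ - 1)² ≤ Δ (Δ - 1)^(b + 1).

module Submission where

open import Defs
open import Data.Nat using (ℕ; _*_; _∸_; _^_; _≤_)
open import Data.Fin using (Fin)
open import Data.List using (List; length)
open import Data.List.Relation.Unary.All using (All)
open import Data.List.Relation.Unary.Unique.Propositional using (Unique)
open import Data.Product using (Σ; ∃; _×_)
open import Function.Definitions using (Injective)
open import Relation.Binary.PropositionalEquality using (_≡_)

open import Data.Bool as Bool using (Bool; true; false; if_then_else_)
open import Data.Empty using (⊥-elim)
open import Data.Fin using (fromℕ<)
open import Data.Fin.Properties using (_≟_)
open import Data.List
  using ([]; _∷_; _++_; map; filter; allFin; applyUpTo; applyDownFrom; head; last)
open import Data.List.Properties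
  using (length-++; length-map; length-tabulate; length-applyUpTo; length-applyDownFrom;
         ++-identityʳ; filter-all; filter-notAll)
open import Data.List.Membership.Propositional using (_∈_; find)
open import Data.List.Membership.Propositional.Properties
  using (∈-filter⁺; ∈-filter⁻; ∈-allFin; ∈-applyUpTo⁻; ∈-applyDownFrom⁻)
open import Data.List.Relation.Unary.All as All using ([]; _∷_; all?)
import Data.List.Relation.Unary.All.Properties as All
open import Data.List.Relation.Unary.AllPairs using ([]; _∷_)
open import Data.List.Relation.Unary.Any as Any using (here; there)
open import Data.List.Relation.Unary.Linked using (Linked; [-]; _∷_)
import Data.List.Relation.Unary.Linked.Properties as Linked
import Data.List.Relation.Unary.Unique.Propositional.Properties as Unique
import Data.List.Relation.Binary.Sublist.Propositional.Properties as Sublist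
open import Data.Maybe using (just)
open import Data.Maybe.Relation.Binary.Connected as Maybe using (just; just-nothing)
open import Data.Nat using (zero; suc; _+_; _<_; z≤n; s≤s; z<s; s≤s⁻¹)
open import Data.Nat.ListAction using (sum)
open import Data.Nat.Properties hiding (_≟_)
open import Data.Nat.Solver using (module +-*-Solver)
open import Data.Product using (_,_; proj₁; proj₂)
open import Data.Sum using (_⊎_; inj₁; inj₂)
open import Function using (_∘_; id)
open import Relation.Binary.Definitions using (DecidableEquality)
open import Relation.Binary.PropositionalEquality
  using (_≢_; refl; sym; trans; cong; cong₂; subst)
open import Relation.Nullary using (¬_; yes; no)
open import Relation.Nullary.Decidable using (¬?)
open import Relation.Unary using (Decidable)
open import Relation.Unary.Properties using (∁?)

module _ {A : Set} where

  last-++-∷ : ∀ xs {y : A} ys → last (xs ++ y ∷ ys) ≡ last (y ∷ ys)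
  last-++-∷ []           _  = refl
  last-++-∷ (_ ∷ [])     _  = refl
  last-++-∷ (_ ∷ x ∷ xs) ys = last-++-∷ (x ∷ xs) ys

  last-applyUpTo : ∀ (f : ℕ → A) n → last (applyUpTo f (suc n)) ≡ just (f n)
  last-applyUpTo f zero    = refl
  last-applyUpTo f (suc n) = last-applyUpTo (f ∘ suc) n

  last-applyDownFrom : ∀ (f : ℕ → A) n → last (applyDownFrom f (suc n)) ≡ just (f 0)
  last-applyDownFrom f zero    = refl
  last-applyDownFrom f (suc n) = last-applyDownFrom f n

  unique∧constant⇒length≤1 : ∀ {x : A} {xs} → Unique xs → All (_≡ x) xs → length xs ≤ 1
  unique∧constant⇒length≤1 {xs = []}        _               _                 = z≤n
  unique∧constant⇒length≤1 {xs = _ ∷ []}    _               _                 = ≤-refl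
  unique∧constant⇒length≤1 {xs = _ ∷ _ ∷ _} ((y≢z ∷ _) ∷ _) (refl ∷ refl ∷ _) = ⊥-elim (y≢z refl)

  ∈⇒0<length : ∀ {x : A} {xs} → x ∈ xs → 0 < length xs
  ∈⇒0<length (here _)  = z<s
  ∈⇒0<length (there _) = z<s

  nth : A → List A → ℕ → A
  nth d []       _       = d
  nth d (x ∷ _)  zero    = x
  nth d (_ ∷ xs) (suc s) = nth d xs s

  ∈-nth : ∀ {d xs s} → s < length xs → nth d xs s ∈ xs
  ∈-nth {xs = _ ∷ _} {zero}  _        = here refl
  ∈-nth {xs = _ ∷ _} {suc _} (s≤s lt) = there (∈-nth lt)

  nth-head : ∀ {d x xs} → head xs ≡ just x → nth d xs 0 ≡ x
  nth-head {xs = _ ∷ _} refl = refl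

  nth-last : ∀ {d x} xs ℓ → last xs ≡ just x → length xs ≡ suc ℓ → nth d xs ℓ ≡ x
  nth-last (_ ∷ [])     zero    refl _   = refl
  nth-last (_ ∷ y ∷ ys) (suc ℓ) eq   len = nth-last (y ∷ ys) ℓ eq (suc-injective len)

  nth-linked : ∀ {R : A → A → Set} {d xs s} → Linked R xs → suc s < length xs →
               R (nth d xs s) (nth d xs (suc s))
  nth-linked             [-]      (s≤s ())
  nth-linked {s = zero}  (r ∷ _)  _        = r
  nth-linked {s = suc _} (_ ∷ rs) (s≤s lt) = nth-linked rs lt

  nth-injective : ∀ {d xs s s'} → Unique xs → s < length xs → s' < length xs →
                  nth d xs s ≡ nth d xs s' → s ≡ s'
  nth-injective {s = zero}  {zero}  _        _        _         _ = refl
  nth-injective {s = zero}  {suc _} (x∉ ∷ _) _        (s≤s lt') e = ⊥-elim (All.lookup x∉ (∈-nth lt') e)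
  nth-injective {s = suc _} {zero}  (x∉ ∷ _) (s≤s lt) _         e = ⊥-elim (All.lookup x∉ (∈-nth lt) (sym e))
  nth-injective {s = suc _} {suc _} (_ ∷ u)  (s≤s lt) (s≤s lt') e = cong suc (nth-injective u lt lt' e)

module _ {A : Set} {P : A → Set} (P? : Decidable P) where

  length-filter+length-filter-∁ : ∀ xs → length (filter P? xs) + length (filter (∁? P?) xs) ≡ length xs
  length-filter+length-filter-∁ []       = refl
  length-filter+length-filter-∁ (x ∷ xs) with P? x
  ... | yes _ = cong suc (length-filter+length-filter-∁ xs)
  ... | no  _ = trans (+-suc _ _) (cong suc (length-filter+length-filter-∁ xs))

module _ {A B : Set} {P : A → Set} {f : A → B} (injectiveOn : ∀ {x y} → P x → P y → f x ≡ f y → x ≡ y) where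

  unique-map⁺ : ∀ {xs} → All P xs → Unique xs → Unique (map f xs)
  unique-map⁺ []         []       = []
  unique-map⁺ (px ∷ pxs) (x∉ ∷ u) =
    All.map⁺ (All.zipWith (λ (x≢y , py) fx≡fy → x≢y (injectiveOn px py fx≡fy)) (x∉ , pxs)) ∷ unique-map⁺ pxs u

module _ {A B : Set} (_≟ᴮ_ : DecidableEquality B) (f : A → B) where

  fibre : B → List A → List A
  fibre w = filter (λ k → f k ≟ᴮ w)

  pigeonhole : ∀ w₀ W K → All (λ k → f k ∈ w₀ ∷ W) K →
               ∃ λ w → length K ≤ length (w₀ ∷ W) * length (fibre w K)
  pigeonhole w₀ [] K covered =
    w₀ , subst (λ L → length K ≤ 1 * length L) (sym (filter-all _ onlyW₀)) (≤-reflexive (sym (*-identityˡ _)))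
    where
    onlyW₀ : All (λ k → f k ≡ w₀) K
    onlyW₀ = All.map (λ { (here e) → e ; (there ()) }) covered
  pigeonhole w₀ (w₁ ∷ W) K covered = larger (pigeonhole w₁ W rest restCovered)
    where
    notW₀? : Decidable (λ k → f k ≢ w₀)
    notW₀? = ∁? (λ k → f k ≟ᴮ w₀)

    rest : List A
    rest = filter notW₀? K

    restCovered : All (λ k → f k ∈ w₁ ∷ W) rest
    restCovered = All.zipWith (λ { (here e , ne) → ⊥-elim (ne e) ; (there m , _) → m })
                              (All.filter⁺ notW₀? covered , All.all-filter notW₀? K)
    inRest : ∀ w → length (fibre w rest) ≤ length (fibre w K)
    inRest w = Sublist.length-mono-≤ (Sublist.filter⁺ _ _ (λ { refl p → p }) (Sublist.filter-⊆ notW₀? K))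
    open ≤-Reasoning
    larger : (∃ λ w → length rest ≤ suc (length W) * length (fibre w rest)) →
             ∃ λ w → length K ≤ length (w₀ ∷ w₁ ∷ W) * length (fibre w K)
    larger (w , restCrowded) with ≤-total (length (fibre w₀ K)) (length (fibre w K))
    ... | inj₁ c₀≤c = w , (begin
          length K                          ≡⟨ sym (length-filter+length-filter-∁ _ K) ⟩
          length (fibre w₀ K) + length rest ≤⟨ +-mono-≤ c₀≤c (≤-trans restCrowded (*-monoʳ-≤ (suc (length W)) (inRest w))) ⟩
          length (fibre w K) + suc (length W) * length (fibre w K) ∎)
    ... | inj₂ c≤c₀ = w₀ , (begin
          length K                          ≡⟨ sym (length-filter+length-filter-∁ _ K) ⟩
          length (fibre w₀ K) + length rest ≤⟨ +-monoʳ-≤ (length (fibre w₀ K)) (≤-trans restCrowded (*-monoʳ-≤ (suc (length W)) (≤-trans (inRest w) c≤c₀))) ⟩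
          length (fibre w₀ K) + suc (length W) * length (fibre w₀ K) ∎)

sum-indicator≡length-filter : ∀ {A : Set} (b : A → Bool) xs →
  sum (map (λ x → if b x then 1 else 0) xs) ≡ length (filter (λ x → b x Bool.≟ true) xs)
sum-indicator≡length-filter b []       = refl
sum-indicator≡length-filter b (x ∷ xs) with b x
... | true  = cong suc (sum-indicator≡length-filter b xs)
... | false = sum-indicator≡length-filter b xs

module _ {n : ℕ} (T : Graph n) where
  open Graph T using (adj)

  Adj-sym : ∀ {u v} → Adj T u v → Adj T v u
  Adj-sym {u} {v} uv = trans (Graph.sym T v u) uv

  record TracesPath (g : ℕ → Fin n) (N : ℕ) : Set where
    field
      adjacent  : ∀ {s} → s < N → Adj T (g s) (g (suc s))
      injective : ∀ {s s'} → s ≤ N → s' ≤ N → g s ≡ g s' → s ≡ s'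
  open TracesPath public

  traces-prefix : ∀ {g N L} → TracesPath g N → L ≤ N → TracesPath g L
  traces-prefix gp L≤N = record
    { adjacent  = λ s<L → adjacent gp (≤-trans s<L L≤N)
    ; injective = λ s≤L s'≤L → injective gp (≤-trans s≤L L≤N) (≤-trans s'≤L L≤N)
    }

  traces-segment : ∀ {g N L} t → TracesPath g N → L + t ≤ N → TracesPath (λ s → g (s + t)) L
  traces-segment t gp L+t≤N = record
    { adjacent  = λ s<L → adjacent gp (≤-trans (+-monoˡ-< t s<L) L+t≤N)
    ; injective = λ s≤L s'≤L e → +-cancelʳ-≡ t _ _
        (injective gp (≤-trans (+-monoˡ-≤ t s≤L) L+t≤N) (≤-trans (+-monoˡ-≤ t s'≤L) L+t≤N) e)
    }

  path⇒traces : ∀ {u v ℓ} → PathOfLength T u v ℓ → ∃ λ g → TracesPath g ℓ × g 0 ≡ u × g ℓ ≡ v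
  path⇒traces {u} {ℓ = ℓ} (ps , (linked , unique) , first , final , len) =
    nth u ps ,
    record { adjacent  = λ s<ℓ → nth-linked linked (inRange (s≤s s<ℓ))
           ; injective = λ s≤ℓ s'≤ℓ → nth-injective unique (inRange (s≤s s≤ℓ)) (inRange (s≤s s'≤ℓ)) } ,
    nth-head first , nth-last ps ℓ final len
    where
    inRange : ∀ {s} → s < suc ℓ → s < length ps
    inRange = subst (_ <_) (sym len)

  MeetOnlyAtStart : (ℕ → Fin n) → ℕ → (ℕ → Fin n) → ℕ → Set
  MeetOnlyAtStart g N h M = ∀ {u v} → 0 < u → u ≤ N → 0 < v → v ≤ M → g u ≢ h v

  join-paths : ∀ {g h N M} → TracesPath g N → TracesPath h M → g 0 ≡ h 0 →
               MeetOnlyAtStart g N h M → PathOfLength T (g N) (h M) (N + M)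
  join-paths {g} {h} {N} {M} gp hp g0≡h0 apart =
    down ++ up , (linked , unique) , refl , lastVertex M , lengthJoin
    where
    down up : List (Fin n)
    down = applyDownFrom g (suc N)
    up   = applyUpTo (h ∘ suc) M

    junction : ∀ L → TracesPath h L → Maybe.Connected (Adj T) (just (g 0)) (head (applyUpTo (h ∘ suc) L))
    junction zero    _   = just-nothing
    junction (suc L) hp' = just (subst (λ z → Adj T z (h 1)) (sym g0≡h0) (adjacent hp' z<s))

    linked : Linked (Adj T) (down ++ up)
    linked = Linked.++⁺
      (Linked.applyDownFrom⁺₁ g (suc N) (λ i<N → Adj-sym (adjacent gp (s≤s⁻¹ i<N))))
      (subst (λ z → Maybe.Connected (Adj T) z (head up)) (sym (last-applyDownFrom g N)) (junction M hp))
      (Linked.applyUpTo⁺₁ (h ∘ suc) M (adjacent hp))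

    unique : Unique (down ++ up)
    unique = Unique.++⁺
      (Unique.applyDownFrom⁺₁ g (suc N) λ j<i i<1+N e →
        <⇒≢ j<i (sym (injective gp (s≤s⁻¹ i<1+N) (≤-trans (<⇒≤ j<i) (s≤s⁻¹ i<1+N)) e)))
      (Unique.applyUpTo⁺₁ (h ∘ suc) M λ i<j j<M e →
        <⇒≢ i<j (suc-injective (injective hp (<-trans i<j j<M) j<M e)))
      disjoint
      where
      disjoint : ∀ {v} → ¬ (v ∈ down × v ∈ up)
      disjoint (v∈down , v∈up) with ∈-applyDownFrom⁻ g v∈down | ∈-applyUpTo⁻ (h ∘ suc) v∈up
      ... | zero  , _     , refl | _ , w<M , e = 0≢1+n (injective hp z≤n w<M (trans (sym g0≡h0) e))
      ... | suc _ , u<1+N , refl | _ , w<M , e = apart z<s (s≤s⁻¹ u<1+N) z<s w<M e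

    lastVertex : ∀ L → last (down ++ applyUpTo (h ∘ suc) L) ≡ just (h L)
    lastVertex zero    = trans (cong last (++-identityʳ down)) (trans (last-applyDownFrom g N) (cong just g0≡h0))
    lastVertex (suc L) = trans (last-++-∷ down _) (last-applyUpTo (h ∘ suc) L)

    lengthJoin : length (down ++ up) ≡ suc (N + M)
    lengthJoin = trans (length-++ down) (cong₂ _+_ (length-applyDownFrom g (suc N)) (length-applyUpTo (h ∘ suc) M))

  path+edge⇒cycle : ∀ {u v ℓ} → PathOfLength T u v ℓ → 2 ≤ ℓ → Adj T v u → HasCycle T
  path+edge⇒cycle {u} {v} (ps , isPath , first , final , len) 2≤ℓ vu =
    ps , u , v , isPath , first , final , subst (3 ≤_) (sym len) (s≤s 2≤ℓ) , vu

  -- A first meeting point g (suc u) = h v would close the cycle g 0, …, g (suc u) = h v, …, h 1.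
  forks-meet-only-at-start : ¬ HasCycle T → ∀ {g h N M} → TracesPath g N → TracesPath h M →
                             g 0 ≡ h 0 → g 1 ≢ h 1 → MeetOnlyAtStart g N h M
  forks-meet-only-at-start acyclic {g} {h} {N} {M} gp hp g0≡h0 g1≢h1 {u} {v} = apartUpTo u ≤-refl
    where
    ApartUpTo : ℕ → Set
    ApartUpTo u = ∀ {u' v} → u' ≤ u → 0 < u' → u' ≤ N → 0 < v → v ≤ M → g u' ≢ h v

    noFirstMeet : ∀ {u v} → suc u ≤ N → 0 < v → v ≤ M → ApartUpTo u → g (suc u) ≢ h v
    noFirstMeet {u} {suc v} 1+u≤N _ 1+v≤M below meet =
      acyclic (path+edge⇒cycle (join-paths (traces-prefix gp 1+u≤N) (traces-prefix hp (<⇒≤ 1+v≤M)) g0≡h0 earlier)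
                               (long u v meet)
                               (subst (Adj T (h v)) (sym meet) (adjacent hp 1+v≤M)))
      where
      earlier : MeetOnlyAtStart g (suc u) h v
      earlier {u'} {v'} 0<u' u'≤1+u 0<v' v'≤v with m≤n⇒m<n∨m≡n u'≤1+u
      ... | inj₁ u'<1+u = below (s≤s⁻¹ u'<1+u) 0<u' (≤-trans u'≤1+u 1+u≤N) 0<v' (≤-trans v'≤v (<⇒≤ 1+v≤M))
      ... | inj₂ refl   = λ e → <⇒≢ (s≤s v'≤v) (injective hp (≤-trans v'≤v (<⇒≤ 1+v≤M)) 1+v≤M (trans (sym e) meet))

      long : ∀ u v → g (suc u) ≡ h (suc v) → 2 ≤ suc u + v
      long zero    zero    e = ⊥-elim (g1≢h1 e)
      long zero    (suc _) _ = s≤s (s≤s z≤n)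
      long (suc _) _       _ = s≤s (s≤s z≤n)

    apartUpTo : ∀ u → ApartUpTo u
    apartUpTo zero    z≤n ()
    apartUpTo (suc u) u'≤1+u with m≤n⇒m<n∨m≡n u'≤1+u
    ... | inj₁ u'<1+u = apartUpTo u (s≤s⁻¹ u'<1+u)
    ... | inj₂ refl   = λ _ 1+u≤N 0<v v≤M → noFirstMeet 1+u≤N 0<v v≤M (apartUpTo u)

  fork-path : ¬ HasCycle T → ∀ {g h N M} → TracesPath g N → TracesPath h M →
              g 0 ≡ h 0 → g 1 ≢ h 1 → PathOfLength T (g N) (h M) (N + M)
  fork-path acyclic gp hp g0≡h0 g1≢h1 = join-paths gp hp g0≡h0 (forks-meet-only-at-start acyclic gp hp g0≡h0 g1≢h1)

  path-cast : ∀ {u u' v v' ℓ ℓ'} → u ≡ u' → v ≡ v' → ℓ ≡ ℓ' → PathOfLength T u v ℓ → PathOfLength T u' v' ℓ'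
  path-cast refl refl refl path = path

  leaf-witnesses-0 : ∀ {v} → IsLeaf T v → Witnesses T v 0
  leaf-witnesses-0 {v} leaf = leaf , v , leaf , (v ∷ [] , ([-] , [] ∷ []) , refl , refl , refl)

  neighbours : Fin n → List (Fin n)
  neighbours v = filter (λ w → adj v w Bool.≟ true) (allFin n)

  length-neighbours : ∀ v → length (neighbours v) ≡ deg T v
  length-neighbours v = sym (sum-indicator≡length-filter (adj v) (allFin n))

  ∈-neighbours : ∀ {v w} → Adj T v w → w ∈ neighbours v
  ∈-neighbours {v} {w} vw = ∈-filter⁺ (λ w → adj v w Bool.≟ true) (∈-allFin w) vw

  neighboursExcept : Fin n → Fin n → List (Fin n)
  neighboursExcept v u = filter (λ w → ¬? (w ≟ u)) (neighbours v)

  ∈-neighboursExcept : ∀ {v u w} → Adj T v w → w ≢ u → w ∈ neighboursExcept v u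
  ∈-neighboursExcept {u = u} vw w≢u = ∈-filter⁺ (λ w → ¬? (w ≟ u)) (∈-neighbours vw) w≢u

  length-neighboursExcept : ∀ {v u} → Adj T v u → length (neighboursExcept v u) < deg T v
  length-neighboursExcept {v} {u} vu = subst (length (neighboursExcept v u) <_) (length-neighbours v)
    (filter-notAll (λ w → ¬? (w ≟ u)) (neighbours v) (Any.map (λ u≡w w≢u → w≢u (sym u≡w)) (∈-neighbours vu)))

module PrefixTree {I V : Set} (_≟ⱽ_ : DecidableEquality V) (p : I → ℕ → V) where

  AgreeUpTo : ℕ → I → I → Set
  AgreeUpTo j k i = ∀ {s} → s ≤ j → p k s ≡ p i s

  agree-refl : ∀ {j i} → AgreeUpTo j i i
  agree-refl _ = refl

  agree-sym : ∀ {j k i} → AgreeUpTo j k i → AgreeUpTo j i k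
  agree-sym k~i s≤j = sym (k~i s≤j)

  agree-trans : ∀ {j k i l} → AgreeUpTo j k i → AgreeUpTo j i l → AgreeUpTo j k l
  agree-trans k~i i~l s≤j = trans (k~i s≤j) (i~l s≤j)

  agree-≤ : ∀ {j j' k i} → j' ≤ j → AgreeUpTo j k i → AgreeUpTo j' k i
  agree-≤ j'≤j k~i s≤j' = k~i (≤-trans s≤j' j'≤j)

  agree-suc : ∀ {j k i} → AgreeUpTo j k i → p k (suc j) ≡ p i (suc j) → AgreeUpTo (suc j) k i
  agree-suc k~i next s≤1+j with m≤n⇒m<n∨m≡n s≤1+j
  ... | inj₁ s<1+j = k~i (s≤s⁻¹ s<1+j)
  ... | inj₂ refl  = next

  BranchesAt : I → ℕ → Set
  BranchesAt i t = ∃ λ k → AgreeUpTo t k i × p k (suc t) ≢ p i (suc t)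

  branchesAt-transfer : ∀ {t i i'} → AgreeUpTo (suc t) i' i → BranchesAt i t → BranchesAt i' t
  branchesAt-transfer i'~i (k , k~i , differ) =
    k , agree-trans k~i (agree-sym (agree-≤ (n≤1+n _) i'~i)) , λ e → differ (trans e (i'~i ≤-refl))

  BranchLevels : ℕ → I → List ℕ → Set
  BranchLevels j i B = Unique B × All (λ t → j ≤ t × BranchesAt i t) B

  record Group (j : ℕ) (i : I) (K : List I) : Set where
    field
      unique : Unique K
      member : i ∈ K
      agree  : All (λ k → AgreeUpTo j k i) K

  NextWithin : ℕ → I → List V → Set
  NextWithin j i W = ∀ {k} → AgreeUpTo j k i → p k (suc j) ∈ W

  split : ∀ {j i K W} → Group j i K → NextWithin j i W →
          ∃ λ i' → AgreeUpTo j i' i × ∃ λ K' → Group (suc j) i' K' ×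
            (length K ≤ length K' ⊎ length K ≤ length W * length K' × BranchesAt i' j)
  split {W = []} G next with next agree-refl
  ... | ()
  split {j} {i} {K} {w₀ ∷ W} G next
    with pigeonhole _≟ⱽ_ (λ k → p k (suc j)) w₀ W K (All.map next (Group.agree G))
  ... | w , crowded = i' , i'~i , K' , group , growth
    where
    open Group G
    lands? : Decidable (λ k → p k (suc j) ≡ w)
    lands? k = p k (suc j) ≟ⱽ w

    K' : List I
    K' = filter lands? K

    occupied : ∀ {c} (L : List I) → length K ≤ c * length L → ∃ λ k → k ∈ L
    occupied {c} []      |K|≤0 = ⊥-elim (<⇒≱ (∈⇒0<length member) (subst (length K ≤_) (*-zeroʳ c) |K|≤0))
    occupied     (k ∷ _) _     = k , here refl

    i' : I
    i' = proj₁ (occupied {length (w₀ ∷ W)} K' crowded)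

    i'∈K' : i' ∈ K'
    i'∈K' = proj₂ (occupied {length (w₀ ∷ W)} K' crowded)

    inK : ∀ {k} → k ∈ K' → AgreeUpTo j k i × p k (suc j) ≡ w
    inK k∈K' = let k∈K , k↦w = ∈-filter⁻ lands? {xs = K} k∈K' in All.lookup agree k∈K , k↦w

    i'~i : AgreeUpTo j i' i
    i'~i = proj₁ (inK i'∈K')

    group : Group (suc j) i' K'
    group = record
      { unique = Unique.filter⁺ lands? unique
      ; member = i'∈K'
      ; agree  = All.tabulate λ k∈K' →
          agree-suc (agree-trans (proj₁ (inK k∈K')) (agree-sym i'~i)) (trans (proj₂ (inK k∈K')) (sym (proj₂ (inK i'∈K'))))
      }

    growth : length K ≤ length K' ⊎ length K ≤ length (w₀ ∷ W) * length K' × BranchesAt i' j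
    growth with all? lands? K
    ... | yes all = inj₁ (≤-reflexive (cong length (sym (filter-all lands? all))))
    ... | no ¬all with find (All.¬All⇒Any¬ lands? K ¬all)
    ...   | k , k∈K , k↛w = inj₂ (crowded , k , agree-trans (All.lookup agree k∈K) (agree-sym i'~i) ,
                                  λ e → k↛w (trans e (proj₂ (inK i'∈K'))))

  module Descent (a D : ℕ) (separated : ∀ {k i} → p k a ≡ p i a → k ≡ i)
                 (narrow : ∀ {j i} → 0 < j → j < a → ∃ λ W → length W ≤ D × NextWithin j i W) where

    branchesAt⇒< : ∀ {i t} → BranchesAt i t → t < a
    branchesAt⇒< {t = t} (k , k~i , differ) with a ≤? t
    ... | no a≰t = ≰⇒> a≰t
    ... | yes a≤t with separated (k~i a≤t)
    ...   | refl = ⊥-elim (differ refl)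

    descend : ∀ d {j i K} → 0 < j → d + j ≡ a → Group j i K →
              ∃ λ i' → AgreeUpTo j i' i × ∃ λ B → BranchLevels j i' B × length K ≤ D ^ length B
    descend zero {i = i} _ refl G =
      i , agree-refl , [] , ([] , []) ,
      unique∧constant⇒length≤1 (Group.unique G) (All.map (λ k~i → separated (k~i ≤-refl)) (Group.agree G))
    descend (suc d) {j} {i} {K} 0<j d+j≡a G
      with narrow 0<j (≤-trans (s≤s (m≤n+m j d)) (≤-reflexive d+j≡a))
    ... | W , |W|≤D , next with split G next
    ... | i₁ , i₁~i , K₁ , G₁ , growth with descend d z<s (trans (+-suc d j) d+j≡a) G₁
    ... | i₂ , i₂~i₁ , B , (unique-B , levels) , small =
      i₂ , agree-trans (agree-≤ (n≤1+n j) i₂~i₁) i₁~i , extend growth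
      where
      below : All (λ t → j ≤ t × BranchesAt i₂ t) B
      below = All.map (λ (j<t , br) → <⇒≤ j<t , br) levels

      extend : length K ≤ length K₁ ⊎ length K ≤ length W * length K₁ × BranchesAt i₁ j →
               ∃ λ B' → BranchLevels j i₂ B' × length K ≤ D ^ length B'
      extend (inj₁ |K|≤|K₁|)       = B , (unique-B , below) , ≤-trans |K|≤|K₁| small
      extend (inj₂ (|K|≤ , branch)) =
        j ∷ B ,
        (All.map (λ (j<t , _) → <⇒≢ j<t) levels ∷ unique-B , (≤-refl , branchesAt-transfer i₂~i₁ branch) ∷ below) ,
        ≤-trans |K|≤ (*-mono-≤ |W|≤D small)

    descend-from-root : ∀ {Δ i K W} → 1 ≤ a → D ≤ Δ → length W ≤ Δ → Group 0 i K → NextWithin 0 i W →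
               ∃ λ i' → ∃ λ B → BranchLevels 0 i' B × length K * D ≤ Δ * D ^ length B
    descend-from-root {Δ} {K = K} {W} 1≤a D≤Δ |W|≤Δ G next with split G next
    ... | i₁ , _ , K₁ , G₁ , growth with descend (a ∸ 1) z<s (m∸n+n≡m 1≤a) G₁
    ... | i₂ , i₂~i₁ , B , (unique-B , levels) , small = i₂ , extend growth
      where
      open ≤-Reasoning
      below : All (λ t → 0 ≤ t × BranchesAt i₂ t) B
      below = All.map (λ (_ , br) → z≤n , br) levels

      extend : length K ≤ length K₁ ⊎ length K ≤ length W * length K₁ × BranchesAt i₁ 0 →
               ∃ λ B' → BranchLevels 0 i₂ B' × length K * D ≤ Δ * D ^ length B'
      extend (inj₁ |K|≤|K₁|) = B , (unique-B , below) , (begin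
        length K * D       ≤⟨ *-mono-≤ (≤-trans |K|≤|K₁| small) D≤Δ ⟩
        D ^ length B * Δ   ≡⟨ *-comm (D ^ length B) Δ ⟩
        Δ * D ^ length B   ∎)
      extend (inj₂ (|K|≤ , branch)) =
        0 ∷ B ,
        (All.map (λ (0<t , _) → <⇒≢ 0<t) levels ∷ unique-B , (z≤n , branchesAt-transfer i₂~i₁ branch) ∷ below) ,
        (begin
          length K * D               ≤⟨ *-monoˡ-≤ D (≤-trans |K|≤ (*-mono-≤ |W|≤Δ small)) ⟩
          Δ * D ^ length B * D       ≡⟨ *-assoc Δ (D ^ length B) D ⟩
          Δ * (D ^ length B * D)     ≡⟨ cong (Δ *_) (*-comm (D ^ length B) D) ⟩
          Δ * D ^ suc (length B)     ∎)

module LeavesAtDepth {n : ℕ} (T : Graph n) (acyclic : ¬ HasCycle T) (Δ : ℕ) (maxDeg : MaxDegAtMost T Δ)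
                     (r : Fin n) (a : ℕ) (1≤a : 1 ≤ a) {m : ℕ} (x : Fin m → Fin n)
                     (x-injective : Injective _≡_ _≡_ x) (leaf : ∀ i → IsLeaf T (x i))
                     (dist : ∀ i → Dist T r (x i) a) where

  trace : ∀ i → ∃ λ g → TracesPath T g a × g 0 ≡ r × g a ≡ x i
  trace i = path⇒traces T (proj₁ (dist i))

  geodesic : Fin m → ℕ → Fin n
  geodesic i = proj₁ (trace i)

  geodesic-traces : ∀ i → TracesPath T (geodesic i) a
  geodesic-traces i = proj₁ (proj₂ (trace i))

  geodesic-start : ∀ i → geodesic i 0 ≡ r
  geodesic-start i = proj₁ (proj₂ (proj₂ (trace i)))

  geodesic-end : ∀ i → geodesic i a ≡ x i
  geodesic-end i = proj₂ (proj₂ (proj₂ (trace i)))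

  D : ℕ
  D = Δ ∸ 1

  open PrefixTree _≟_ geodesic

  separated : ∀ {k i} → geodesic k a ≡ geodesic i a → k ≡ i
  separated {k} {i} e = x-injective (trans (sym (geodesic-end k)) (trans e (geodesic-end i)))

  -- Past the root, the predecessor of geodesic i j is a neighbour that no geodesic continues to.
  narrow : ∀ {j i} → 0 < j → j < a → ∃ λ W → length W ≤ D × NextWithin j i W
  narrow {suc j} {i} _ 1+j<a =
    neighboursExcept T (geodesic i (suc j)) (geodesic i j) ,
    ∸-monoˡ-≤ 1 (≤-trans (length-neighboursExcept T parent) (maxDeg _)) ,
    onward
    where
    j<a : j < a
    j<a = <-trans (n<1+n j) 1+j<a

    parent : Adj T (geodesic i (suc j)) (geodesic i j)
    parent = Adj-sym T (adjacent (geodesic-traces i) j<a)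

    onward : NextWithin (suc j) i (neighboursExcept T (geodesic i (suc j)) (geodesic i j))
    onward {k} k~i = ∈-neighboursExcept T forward notBack
      where
      forward : Adj T (geodesic i (suc j)) (geodesic k (suc (suc j)))
      forward = subst (λ v → Adj T v _) (k~i ≤-refl) (adjacent (geodesic-traces k) 1+j<a)

      notBack : geodesic k (suc (suc j)) ≢ geodesic i j
      notBack e = <⇒≢ (m<n⇒m<1+n (n<1+n j))
        (sym (injective (geodesic-traces k) 1+j<a (<⇒≤ j<a) (trans e (sym (k~i (n≤1+n j))))))

  open Descent a D separated narrow

  next-from-root : ∀ {i} → NextWithin 0 i (neighbours T r)
  next-from-root {k = k} _ =
    ∈-neighbours T (subst (λ v → Adj T v (geodesic k 1)) (geodesic-start k) (adjacent (geodesic-traces k) 1≤a))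

  whole-family : ∀ i → Group 0 i (allFin m)
  whole-family i = record
    { unique = Unique.allFin⁺ m
    ; member = ∈-allFin i
    ; agree  = All.tabulate λ {k} _ → λ { z≤n → trans (geodesic-start k) (sym (geodesic-start i)) }
    }

  many-branch-levels : Fin m → ∃ λ i → ∃ λ B → BranchLevels 0 i B × m * D ≤ Δ * D ^ length B
  many-branch-levels i₀ =
    let i , B , levels , bound = descend-from-root 1≤a (m∸n≤m Δ 1) (≤-trans (≤-reflexive (length-neighbours T r)) (maxDeg r))
                                          (whole-family i₀) next-from-root
    in i , B , levels , subst (λ c → c * D ≤ Δ * D ^ length B) (length-tabulate {n = m} id) bound

  gap : ℕ → ℕ
  gap t = 2 * (a ∸ t)

  gap-injective : ∀ {t t'} → t ≤ a → t' ≤ a → gap t ≡ gap t' → t ≡ t'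
  gap-injective t≤a t'≤a e = ∸-cancelˡ-≡ t≤a t'≤a (*-cancelˡ-≡ _ _ 2 e)

  gap≤ : ∀ t → gap t ≤ 2 * a
  gap≤ t = *-monoʳ-≤ 2 (m∸n≤m a t)

  branch-witnesses : ∀ {i t} → BranchesAt i t → Witnesses T (x i) (gap t)
  branch-witnesses {i} {t} branch@(k , k~i , differ) =
    leaf i , x k , leaf k ,
    path-cast T (ends i) (ends k) (cong (a ∸ t +_) (sym (+-identityʳ (a ∸ t))))
      (fork-path T acyclic (segment i) (segment k) (sym (k~i ≤-refl)) (differ ∘ sym))
    where
    t≤a : t ≤ a
    t≤a = <⇒≤ (branchesAt⇒< branch)
    segment : ∀ l → TracesPath T (λ s → geodesic l (s + t)) (a ∸ t)
    segment l = traces-segment T t (geodesic-traces l) (≤-reflexive (m∸n+n≡m t≤a))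
    ends : ∀ l → geodesic l (a ∸ t + t) ≡ x l
    ends l = trans (cong (geodesic l) (m∸n+n≡m t≤a)) (geodesic-end l)

  -- Level a stands for the trivial path, of length gap a = 0.
  gaps-unique : ∀ {i B} → BranchLevels 0 i B → Unique (map gap (a ∷ B))
  gaps-unique (unique-B , levels) =
    unique-map⁺ gap-injective (≤-refl ∷ All.map (<⇒≤ ∘ branchesAt⇒< ∘ proj₂) levels)
                (All.map (λ (_ , br) → <⇒≢ (branchesAt⇒< br) ∘ sym) levels ∷ unique-B)

  gaps-witnessed : ∀ {i B} → BranchLevels 0 i B → All (λ ℓ → ℓ ≤ 2 * a × Witnesses T (x i) ℓ) (map gap (a ∷ B))
  gaps-witnessed {i} {B} (_ , levels) = All.map⁺ {xs = a ∷ B}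
    ((gap≤ a , subst (Witnesses T (x i)) (cong (2 *_) (sym (n∸n≡0 a))) (leaf-witnesses-0 T (leaf i))) ∷
     All.map (λ {t} (_ , br) → gap≤ t , branch-witnesses br) levels)

  times-D : ∀ {b} → m * D ≤ Δ * D ^ b → m * D ^ 2 ≤ Δ * D ^ suc b
  times-D {b} bound = begin
    m * D ^ 2          ≡⟨ solve 2 (λ m d → m :* (d :^ 2) := m :* d :* d) refl m D ⟩
    m * D * D          ≤⟨ *-monoˡ-≤ D bound ⟩
    Δ * D ^ b * D      ≡⟨ solve 3 (λ e d q → e :* q :* d := e :* (d :* q)) refl Δ D (D ^ b) ⟩
    Δ * D ^ suc b      ∎
    where
    open ≤-Reasoning
    open +-*-Solver

-- Δ ≥ 3 only makes log_(Δ-1) meaningful; the bound in this multiplicative form holds for every Δ.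
lemma2p1 : (Δ : ℕ) → 3 ≤ Δ →
    (n : ℕ) (T : Graph n) → IsTree T → MaxDegAtMost T Δ →
    (r : Fin n) (a : ℕ) → 1 ≤ a →
    (m : ℕ) → 1 ≤ m → (x : Fin m → Fin n) → Injective _≡_ _≡_ x →
    (∀ i → IsLeaf T (x i)) → (∀ i → Dist T r (x i) a) →
    ∃ λ (i : Fin m) → Σ (List ℕ) λ L →
      Unique L × All (λ ℓ → ℓ ≤ 2 * a × Witnesses T (x i) ℓ) L ×
      m * ((Δ ∸ 1) ^ 2) ≤ Δ * ((Δ ∸ 1) ^ length L)
lemma2p1 Δ _ n T (_ , acyclic) maxDeg r a 1≤a m 1≤m x x-injective leaf dist =
  let open LeavesAtDepth T acyclic Δ maxDeg r a 1≤a x x-injective leaf dist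
      i , B , levels , bound = many-branch-levels (fromℕ< {0} 1≤m)
  in  i , map gap (a ∷ B) , gaps-unique levels , gaps-witnessed levels ,
      subst (λ ℓ → m * D ^ 2 ≤ Δ * D ^ ℓ) (sym (length-map gap (a ∷ B))) (times-D {length B} bound)
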